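{- Let $k$ be a positive integer and let $A_1=\{v^1_1,\dots,v^1_{4k-3}\}$, $A_2=\{v^2_1,\dots,v^2_{4k-3}\}$ be disjoint vertex sets and $v_1^3$ a further vertex. For $i\in[1,k-1]$ define the sets of $3$-edges \begin{align*} \mathcal{E}_{1,i} &= \{v_{2i-1}^1 v_j^2 v_{j+1}^2: j\in [2i-1, 4k-2-2i]\},\\ \mathcal{E}_{2,i} &= \{v_j^1 v_{j+1}^1 v_{4k-1-2i}^2: j\in [2i-1, 4k-2-2i]\},\\ \mathcal{E}_{3,i} &= \{v_{4k-1-2i}^1 v_j^2 v_{j+1}^2: j\in [2i+1, 4k-2-2i]\},\\ \mathcal{E}_{4,i} &= \{v_j^1 v_{j+1}^1 v_{2i+1}^2: j\in [2i+1, 4k-2-2i]\}, \end{align*} $\mathcal{E}_i=\mathcal{E}_{1,i}\cup\mathcal{E}_{2,i}\cup\mathcal{E}_{3,i}\cup\mathcal{E}_{4,i}$, $\mathcal{E}=\bigcup_{i=1}^{k-1}\mathcal{E}_i$, and \[\mathcal{F}=\bigcup_{j=1}^{4k-4}\bigcup_{l=1}^{2}\{v_j^l v_{j+1}^l v_1^3\}.\] Then there are no three distinct edges in $\mathcal{E}\cup\mathcal{F}$ whose union consists of exactly $4$ vertices.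
   Context: A $3$-edge $abc$ denotes the $3$-element set $\{a,b,c\}$; $[a,b]$ denotes the set of integers between $a$ and $b$ inclusive. -}

module Defs where

open import Data.Nat using (ℕ; _+_; _*_; _∸_; _≤_)
open import Data.Product using (Σ; _×_; _,_)
open import Data.Sum using (_⊎_)
open import Relation.Binary.PropositionalEquality using (_≡_)
open import Relation.Nullary using (¬_)
open import Function.Bundles using (_⇔_)

data Vtx : Set where
  v1 : ℕ → Vtx
  v2 : ℕ → Vtx
  v3 : Vtx

-- A 3-edge xyz is represented by a triple; as a set it is {x, y, z}.
Edge : Set
Edge = Vtx × Vtx × Vtx

_∈ₑ_ : Vtx → Edge → Set
w ∈ₑ (x , y , z) = (w ≡ x) ⊎ (w ≡ y) ⊎ (w ≡ z)

SameEdge : Edge → Edge → Set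
SameEdge e f = ∀ w → (w ∈ₑ e) ⇔ (w ∈ₑ f)

_∈[_,_] : ℕ → ℕ → ℕ → Set
j ∈[ a , b ] = (a ≤ j) × (j ≤ b)

E1 E2 E3 E4 : ℕ → ℕ → Edge → Set
E1 k i e = Σ ℕ λ j → j ∈[ 2 * i ∸ 1 , 4 * k ∸ 2 ∸ 2 * i ] × (e ≡ (v1 (2 * i ∸ 1) , v2 j , v2 (j + 1)))
E2 k i e = Σ ℕ λ j → j ∈[ 2 * i ∸ 1 , 4 * k ∸ 2 ∸ 2 * i ] × (e ≡ (v1 j , v1 (j + 1) , v2 (4 * k ∸ 1 ∸ 2 * i)))
E3 k i e = Σ ℕ λ j → j ∈[ 2 * i + 1 , 4 * k ∸ 2 ∸ 2 * i ] × (e ≡ (v1 (4 * k ∸ 1 ∸ 2 * i) , v2 j , v2 (j + 1)))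
E4 k i e = Σ ℕ λ j → j ∈[ 2 * i + 1 , 4 * k ∸ 2 ∸ 2 * i ] × (e ≡ (v1 j , v1 (j + 1) , v2 (2 * i + 1)))

InE : ℕ → Edge → Set
InE k e = Σ ℕ λ i → i ∈[ 1 , k ∸ 1 ] × (E1 k i e ⊎ E2 k i e ⊎ E3 k i e ⊎ E4 k i e)

InF : ℕ → Edge → Set
InF k e = Σ ℕ λ j → j ∈[ 1 , 4 * k ∸ 4 ] ×
  ((e ≡ (v1 j , v1 (j + 1) , v3)) ⊎ (e ≡ (v2 j , v2 (j + 1) , v3)))

InEF : ℕ → Edge → Set
InEF k e = InE k e ⊎ InF k e

Union4 : Edge → Edge → Edge → Set
Union4 e f g = Σ Vtx λ a → Σ Vtx λ b → Σ Vtx λ c → Σ Vtx λ d →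
  ¬ (a ≡ b) × ¬ (a ≡ c) × ¬ (a ≡ d) × ¬ (b ≡ c) × ¬ (b ≡ d) × ¬ (c ≡ d) ×
  (∀ w → ((w ∈ₑ e) ⊎ (w ∈ₑ f) ⊎ (w ∈ₑ g)) ⇔ ((w ≡ a) ⊎ (w ≡ b) ⊎ (w ≡ c) ⊎ (w ≡ d)))

{-# OPTIONS --safe #-}
-- Every edge of 𝓔 ∪ 𝓕 is a wedge: a consecutive pair {vᶜⱼ, vᶜⱼ₊₁} of one class c ∈ {1, 2}
-- plus an apex outside class c, namely v³₁ or an odd-indexed vertex of the other class.
-- Three distinct wedges span at least five vertices. If they all have class c, then
-- m distinct bases cover m + 1 vertices of class c, and wedges sharing a base have
-- distinct apexes. If two of them have class c, they either have distinct bases (three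
-- vertices of class c) or distinct apexes, which together with the consecutive pair of the
-- third wedge give three vertices outside class c, since two odd indices are never adjacent.
module Submission where

open import Defs
open import Data.Nat using (ℕ; suc; _+_; _*_; _∸_; _≤_; _<_; z≤n; s≤s)
open import Data.Nat.Properties
  using (_≟_; <-cmp; <-trans; <⇒≢; m<m+n; +-monoˡ-<; +-comm; *-suc; even≢odd; 1+n≰n;
         m≤n⇒∃[o]m+o≡n; ∸-+-assoc; m+n∸m≡n)
open import Data.Nat.Tactic.RingSolver using (solve-∀)
open import Data.Fin using (Fin)
open import Data.Fin.Properties using (injective⇒≤)
open import Data.Vec using (Vec; []; _∷_; _++_; map; lookup)
open import Data.Vec.Membership.Propositional using (_∈_)
open import Data.Vec.Relation.Unary.Any using (here; there; index)
open import Data.Vec.Relation.Unary.Any.Properties using (lookup-index)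
open import Data.Vec.Relation.Unary.All as All using (All; []; _∷_)
import Data.Vec.Relation.Unary.All.Properties as Allₚ
open import Data.Vec.Relation.Unary.AllPairs using ([]; _∷_)
import Data.Vec.Relation.Unary.AllPairs.Properties as AllPairsₚ
open import Data.Vec.Relation.Unary.Unique.Propositional using (Unique)
import Data.Vec.Relation.Unary.Unique.Propositional.Properties as Uniqueₚ
open import Data.Product using (Σ; ∃-syntax; _×_; _,_; proj₁; proj₂)
open import Data.Sum using (_⊎_; inj₁; inj₂; [_,_])
open import Function using (_∘_)
open import Function.Bundles using (Equivalence; mk⇔)
open import Function.Construct.Identity using (⇔-id)
open import Function.Construct.Symmetry using (⇔-sym)
open import Function.Construct.Composition using (_⇔-∘_)
open import Relation.Binary.PropositionalEquality
  using (_≡_; _≢_; refl; sym; trans; cong; subst; ≢-sym; module ≡-Reasoning)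
open import Relation.Binary.Definitions using (tri<; tri≈; tri>)
open import Relation.Nullary using (¬_; yes; no; contradiction)
open import Relation.Unary using (_⊆_; _∪_; _∩_)

private
  variable
    A B : Set
    Q R : A → Set
    m n : ℕ

Odd : ℕ → Set
Odd n = ∃[ m ] n ≡ suc (2 * m)

odd⇒¬odd[n+1] : ∀ {n} → Odd n → ¬ Odd (n + 1)
odd⇒¬odd[n+1] {n} (a , refl) (b , n+1≡1+2b) =
  even≢odd (suc a) b (trans (*-suc 2 a) (trans (+-comm 1 n) n+1≡1+2b))

odd-2i∸1 : ∀ {i} → 1 ≤ i → Odd (2 * i ∸ 1)
odd-2i∸1 {suc i} (s≤s z≤n) = i , cong (_∸ 1) (*-suc 2 i)

odd-2i+1 : ∀ i → Odd (2 * i + 1)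
odd-2i+1 i = i , +-comm (2 * i) 1

odd-4k∸1∸2i : ∀ {k i} → 1 ≤ k → i ≤ k ∸ 1 → Odd (4 * k ∸ 1 ∸ 2 * i)
odd-4k∸1∸2i {suc k} {i} (s≤s z≤n) i≤k with m≤n⇒∃[o]m+o≡n i≤k
... | d , refl = i + 2 * d + 1 , (begin
  4 * suc (i + d) ∸ 1 ∸ 2 * i                               ≡⟨ ∸-+-assoc (4 * suc (i + d)) 1 (2 * i) ⟩
  4 * suc (i + d) ∸ (1 + 2 * i)                             ≡⟨ cong (_∸ (1 + 2 * i)) (split i d) ⟩
  (1 + 2 * i) + suc (2 * (i + 2 * d + 1)) ∸ (1 + 2 * i)     ≡⟨ m+n∸m≡n (1 + 2 * i) _ ⟩
  suc (2 * (i + 2 * d + 1))                                 ∎)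
  where
  open ≡-Reasoning
  split : ∀ i d → 4 * suc (i + d) ≡ (1 + 2 * i) + suc (2 * (i + 2 * d + 1))
  split = solve-∀

AtLeast : ℕ → (A → Set) → Set
AtLeast {A} n Q = Σ (Vec A n) λ xs → Unique xs × All Q xs

AtLeast-weaken : Q ⊆ R → AtLeast n Q → AtLeast n R
AtLeast-weaken Q⊆R (xs , xs! , qs) = xs , xs! , All.map Q⊆R qs

AtLeast-map : (f : A → B) → (∀ {x y} → f x ≡ f y → x ≡ y) → (∀ {x} → Q x → R (f x)) →
              AtLeast n Q → AtLeast n R
AtLeast-map f f-injective Q⇒R∘f (xs , xs! , qs) =
  map f xs , Uniqueₚ.map⁺ f-injective xs! , Allₚ.map⁺ (All.map Q⇒R∘f qs)

AtLeast-cons : ∀ {x} → Q x → AtLeast n (λ y → Q y × y ≢ x) → AtLeast (suc n) Q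
AtLeast-cons {x = x} qx (xs , xs! , qs) =
  x ∷ xs , All.map (≢-sym ∘ proj₂) qs ∷ xs! , qx ∷ All.map proj₁ qs

AtLeast-++ : (∀ {x y} → Q x → R y → x ≢ y) → AtLeast m Q → AtLeast n R → AtLeast (m + n) (Q ∪ R)
AtLeast-++ disjoint (xs , xs! , qs) (ys , ys! , rs) =
  xs ++ ys ,
  AllPairsₚ.++⁺ xs! ys! (All.map (λ qx → All.map (disjoint qx) rs) qs) ,
  Allₚ.++⁺ (All.map inj₁ qs) (All.map inj₂ rs)

single : ∀ {x} → Q x → AtLeast 1 Q
single {x = x} qx = x ∷ [] , [] ∷ [] , qx ∷ []

distinct₂ : ∀ {x y} → x ≢ y → Q x → Q y → AtLeast 2 Q
distinct₂ {x = x} {y} x≢y qx qy = x ∷ y ∷ [] , (x≢y ∷ []) ∷ [] ∷ [] , qx ∷ qy ∷ []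

distinct₃ : ∀ {x y z} → x ≢ y → x ≢ z → y ≢ z → Q x → Q y → Q z → AtLeast 3 Q
distinct₃ {x = x} {y} {z} x≢y x≢z y≢z qx qy qz =
  x ∷ y ∷ z ∷ [] , (x≢y ∷ x≢z ∷ []) ∷ (y≢z ∷ []) ∷ [] ∷ [] , qx ∷ qy ∷ qz ∷ []

AtLeast⇒≤ : ∀ {ys : Vec A m} → AtLeast n Q → (∀ {x} → Q x → x ∈ ys) → n ≤ m
AtLeast⇒≤ {ys = ys} (xs , xs! , qs) covered = injective⇒≤ position-injective
  where
  position : Fin _ → Fin _
  position i = index (covered (Allₚ.lookup⁺ qs i))
  lookup-position : ∀ i → lookup xs i ≡ lookup ys (position i)
  lookup-position i = lookup-index (covered (Allₚ.lookup⁺ qs i))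
  position-injective : ∀ {i j} → position i ≡ position j → i ≡ j
  position-injective {i} {j} eq = Uniqueₚ.lookup-injective xs! i j
    (trans (lookup-position i) (trans (cong (lookup ys) eq) (sym (lookup-position j))))

n<n+1 : ∀ n → n < n + 1
n<n+1 n = m<m+n n (s≤s z≤n)

n≢n+1 : ∀ n → n ≢ n + 1
n≢n+1 n = <⇒≢ (n<n+1 n)

OnPair : (ℕ → Set) → ℕ → Set
OnPair Q j = Q j × Q (j + 1)

consecutive : ∀ {Q j} → OnPair Q j → AtLeast 2 Q
consecutive {j = j} (qj , qj+1) = distinct₂ (n≢n+1 j) qj qj+1

two-consecutive-pairs : ∀ {Q j l} → j ≢ l → OnPair Q j → OnPair Q l → AtLeast 3 Q
two-consecutive-pairs {j = j} {l} j≢l (qj , qj+1) (ql , ql+1) with l ≟ j + 1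
... | yes refl = distinct₃ (n≢n+1 j) (<⇒≢ (<-trans (n<n+1 j) (n<n+1 (j + 1)))) (n≢n+1 (j + 1)) qj qj+1 ql+1
... | no l≢j+1 = distinct₃ (n≢n+1 j) j≢l (≢-sym l≢j+1) qj qj+1 ql

three-consecutive-pairs-max : ∀ {Q j l m} → j < m → l < m → j ≢ l →
                              OnPair Q j → OnPair Q l → Q (m + 1) → AtLeast 4 Q
three-consecutive-pairs-max {Q} {j} {l} {m} j<m l<m j≢l qj ql qm+1 =
  AtLeast-cons qm+1 (two-consecutive-pairs j≢l (below j<m qj) (below l<m ql))
  where
  below : ∀ {r} → r < m → OnPair Q r → OnPair (λ s → Q s × s ≢ m + 1) r
  below r<m (qr , qr+1) = (qr , <⇒≢ (<-trans r<m (n<n+1 m))) , (qr+1 , <⇒≢ (+-monoˡ-< 1 r<m))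

three-consecutive-pairs-< : ∀ {Q j l m} → j < l → j ≢ m → l ≢ m →
                            OnPair Q j → OnPair Q l → OnPair Q m → AtLeast 4 Q
three-consecutive-pairs-< {l = l} {m} j<l j≢m l≢m qj ql qm with <-cmp l m
... | tri< l<m _ _ = three-consecutive-pairs-max (<-trans j<l l<m) l<m (<⇒≢ j<l) qj ql (proj₂ qm)
... | tri≈ _ l≡m _ = contradiction l≡m l≢m
... | tri> _ _ m<l = three-consecutive-pairs-max j<l m<l j≢m qj qm (proj₂ ql)

three-consecutive-pairs : ∀ {Q j l m} → j ≢ l → j ≢ m → l ≢ m →
                          OnPair Q j → OnPair Q l → OnPair Q m → AtLeast 4 Q
three-consecutive-pairs {j = j} {l} j≢l j≢m l≢m qj ql qm with <-cmp j l
... | tri< j<l _ _ = three-consecutive-pairs-< j<l j≢m l≢m qj ql qm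
... | tri≈ _ j≡l _ = contradiction j≡l j≢l
... | tri> _ _ l<j = three-consecutive-pairs-< l<j l≢m j≢m ql qj qm

odd-points-and-pair : ∀ {Q x y m} → Odd x → Odd y → x ≢ y → Q x → Q y → OnPair Q m → AtLeast 3 Q
odd-points-and-pair {x = x} {y} {m} ox oy x≢y qx qy (qm , qm+1) with m ≟ x | m ≟ y
... | yes refl | _ = distinct₃ x≢y (n≢n+1 x) (λ y≡x+1 → odd⇒¬odd[n+1] ox (subst Odd y≡x+1 oy)) qx qy qm+1
... | no _ | yes refl = distinct₃ x≢y (λ x≡y+1 → odd⇒¬odd[n+1] oy (subst Odd x≡y+1 ox)) (n≢n+1 y) qx qy qm+1
... | no m≢x | no m≢y = distinct₃ x≢y (≢-sym m≢x) (≢-sym m≢y) qx qy qm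

data Class : Set where
  one two : Class

other : Class → Class
other one = two
other two = one

vtx : Class → ℕ → Vtx
vtx one = v1
vtx two = v2

vtx-injective : ∀ c {i j} → vtx c i ≡ vtx c j → i ≡ j
vtx-injective one refl = refl
vtx-injective two refl = refl

vtx≢v3 : ∀ c {i} → vtx c i ≢ v3
vtx≢v3 one ()
vtx≢v3 two ()

InClass : Class → Vtx → Set
InClass c v = ∃[ j ] v ≡ vtx c j

Outside : Class → Vtx → Set
Outside c v = ∀ j → v ≢ vtx c j

v3-outside : ∀ c → Outside c v3
v3-outside c _ = ≢-sym (vtx≢v3 c)

other-outside : ∀ c {i} → Outside c (vtx (other c) i)
other-outside one _ ()
other-outside two _ ()

record Wedge : Set where
  constructor wedge
  field
    class : Class
    base  : ℕ
    apex  : Vtx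

edge : Wedge → Edge
edge (wedge c j a) = vtx c j , vtx c (j + 1) , a

data Apex (c : Class) : Vtx → Set where
  top : Apex c v3
  odd : ∀ {x} → Odd x → Apex c (vtx (other c) x)

apex-outside : ∀ {c a} → Apex c a → Outside c a
apex-outside {c} top = v3-outside c
apex-outside {c} (odd _) = other-outside c

Valid : Wedge → Set
Valid (wedge c _ a) = Apex c a

apexes-≢ : ∀ {c j a b} → wedge c j a ≢ wedge c j b → a ≢ b
apexes-≢ t≢u a≡b = t≢u (cong (wedge _ _) a≡b)

module _ (P : Vtx → Set) where

  Spanned : Wedge → Set
  Spanned (wedge c j a) = OnPair (P ∘ vtx c) j × P a

  Placed : Wedge → Set
  Placed t = Valid t × Spanned t

  split-by-class : ∀ c → AtLeast m (P ∘ vtx c) → AtLeast n (P ∩ Outside c) → AtLeast (m + n) P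
  split-by-class c inside outside = AtLeast-weaken [ proj₁ , proj₁ ]
    (AtLeast-++ {Q = P ∩ InClass c} (λ { (_ , j , refl) (_ , out) → ≢-sym (out j) })
      (AtLeast-map (vtx c) (vtx-injective c) (λ p → p , _ , refl) inside) outside)

  from-other-class : ∀ c → AtLeast n (P ∘ vtx (other c)) → AtLeast n (P ∩ Outside c)
  from-other-class c = AtLeast-map (vtx (other c)) (vtx-injective (other c)) (λ p → p , other-outside c)

  v3-and-pair : ∀ c {m} → P v3 → OnPair (P ∘ vtx (other c)) m → AtLeast 3 (P ∩ Outside c)
  v3-and-pair c p3 pm = AtLeast-cons (p3 , v3-outside c)
    (AtLeast-map (vtx (other c)) (vtx-injective (other c))
      (λ p → (p , other-outside c) , vtx≢v3 (other c)) (consecutive pm))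

  apexes-and-pair : ∀ {c a b m} → Apex c a → Apex c b → a ≢ b → P a → P b →
                    OnPair (P ∘ vtx (other c)) m → AtLeast 3 (P ∩ Outside c)
  apexes-and-pair top top a≢b _ _ _ = contradiction refl a≢b
  apexes-and-pair {c} top (odd _) _ pa _ pm = v3-and-pair c pa pm
  apexes-and-pair {c} (odd _) top _ _ pb pm = v3-and-pair c pb pm
  apexes-and-pair {c} (odd ox) (odd oy) a≢b pa pb pm =
    from-other-class c (odd-points-and-pair ox oy (a≢b ∘ cong (vtx (other c))) pa pb pm)

  apex-point : ∀ {c j a} → Placed (wedge c j a) → (P ∩ Outside c) a
  apex-point (apex , _ , pa) = pa , apex-outside apex

  same-class : ∀ {c j₁ j₂ j₃ a₁ a₂ a₃} →
    Placed (wedge c j₁ a₁) → Placed (wedge c j₂ a₂) → Placed (wedge c j₃ a₃) →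
    wedge c j₁ a₁ ≢ wedge c j₂ a₂ → wedge c j₁ a₁ ≢ wedge c j₃ a₃ → wedge c j₂ a₂ ≢ wedge c j₃ a₃ →
    AtLeast 5 P
  same-class {c} {j₁} {j₂} {j₃} q₁@(_ , s₁ , _) q₂@(_ , s₂ , _) q₃@(_ , s₃ , _) t₁≢t₂ t₁≢t₃ t₂≢t₃
    with j₁ ≟ j₂ | j₁ ≟ j₃ | j₂ ≟ j₃
  ... | yes refl | yes refl | _ = split-by-class c (consecutive s₁)
        (distinct₃ (apexes-≢ t₁≢t₂) (apexes-≢ t₁≢t₃) (apexes-≢ t₂≢t₃) (apex-point q₁) (apex-point q₂) (apex-point q₃))
  ... | yes refl | no j₁≢j₃ | _ = split-by-class c (two-consecutive-pairs j₁≢j₃ s₁ s₃)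
        (distinct₂ (apexes-≢ t₁≢t₂) (apex-point q₁) (apex-point q₂))
  ... | no j₁≢j₂ | yes refl | _ = split-by-class c (two-consecutive-pairs j₁≢j₂ s₁ s₂)
        (distinct₂ (apexes-≢ t₁≢t₃) (apex-point q₁) (apex-point q₃))
  ... | no j₁≢j₂ | no _ | yes refl = split-by-class c (two-consecutive-pairs j₁≢j₂ s₁ s₂)
        (distinct₂ (apexes-≢ t₂≢t₃) (apex-point q₂) (apex-point q₃))
  ... | no j₁≢j₂ | no j₁≢j₃ | no j₂≢j₃ = split-by-class c (three-consecutive-pairs j₁≢j₂ j₁≢j₃ j₂≢j₃ s₁ s₂ s₃)
        (single (apex-point q₁))

  mixed-class : ∀ {c j l m a b d} → Placed (wedge c j a) → Placed (wedge c l b) →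
    Spanned (wedge (other c) m d) → wedge c j a ≢ wedge c l b → AtLeast 5 P
  mixed-class {c} {j} {l} (va , sa , pa) (vb , sb , pb) (sm , _) t≢u with j ≟ l
  ... | no j≢l = split-by-class c (two-consecutive-pairs j≢l sa sb) (from-other-class c (consecutive sm))
  ... | yes refl = split-by-class c (consecutive sa) (apexes-and-pair va vb (apexes-≢ t≢u) pa pb sm)

  three-wedges : ∀ t u w → Placed t → Placed u → Placed w → t ≢ u → t ≢ w → u ≢ w → AtLeast 5 P
  three-wedges (wedge one _ _) (wedge one _ _) (wedge one _ _) = same-class
  three-wedges (wedge two _ _) (wedge two _ _) (wedge two _ _) = same-class
  three-wedges (wedge one _ _) (wedge one _ _) (wedge two _ _) qt qu (_ , sw) t≢u _ _ = mixed-class qt qu sw t≢u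
  three-wedges (wedge two _ _) (wedge two _ _) (wedge one _ _) qt qu (_ , sw) t≢u _ _ = mixed-class qt qu sw t≢u
  three-wedges (wedge one _ _) (wedge two _ _) (wedge one _ _) qt (_ , su) qw _ t≢w _ = mixed-class qt qw su t≢w
  three-wedges (wedge two _ _) (wedge one _ _) (wedge two _ _) qt (_ , su) qw _ t≢w _ = mixed-class qt qw su t≢w
  three-wedges (wedge one _ _) (wedge two _ _) (wedge two _ _) (_ , st) qu qw _ _ u≢w = mixed-class qu qw st u≢w
  three-wedges (wedge two _ _) (wedge one _ _) (wedge one _ _) (_ , st) qu qw _ _ u≢w = mixed-class qu qw st u≢w

  spanned : ∀ {e t} → SameEdge e (edge t) → (_∈ₑ e) ⊆ P → Spanned t
  spanned {t = wedge c j a} e≈t e⊆P = (vertex (inj₁ refl) , vertex (inj₂ (inj₁ refl))) , vertex (inj₂ (inj₂ refl))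
    where
    vertex : ∀ {v} → v ∈ₑ edge (wedge c j a) → P v
    vertex {v} = e⊆P ∘ Equivalence.from (e≈t v)

SameEdge-rotate : ∀ {x y z} → SameEdge (x , y , z) (y , z , x)
SameEdge-rotate w = mk⇔ [ inj₂ ∘ inj₂ , [ inj₁ , inj₂ ∘ inj₁ ] ] [ inj₂ ∘ inj₁ , [ inj₂ ∘ inj₂ , inj₁ ] ]

SameEdge-refl : ∀ {e} → SameEdge e e
SameEdge-refl _ = ⇔-id _

InEF⇒wedge : ∀ {k e} → 1 ≤ k → InEF k e → ∃[ t ] Valid t × SameEdge e (edge t)
InEF⇒wedge _ (inj₁ (i , (1≤i , _) , inj₁ (j , _ , refl))) =
  wedge two j _ , odd (odd-2i∸1 1≤i) , SameEdge-rotate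
InEF⇒wedge 1≤k (inj₁ (i , (_ , i≤k∸1) , inj₂ (inj₁ (j , _ , refl)))) =
  wedge one j _ , odd (odd-4k∸1∸2i 1≤k i≤k∸1) , SameEdge-refl
InEF⇒wedge 1≤k (inj₁ (i , (_ , i≤k∸1) , inj₂ (inj₂ (inj₁ (j , _ , refl))))) =
  wedge two j _ , odd (odd-4k∸1∸2i 1≤k i≤k∸1) , SameEdge-rotate
InEF⇒wedge _ (inj₁ (i , _ , inj₂ (inj₂ (inj₂ (j , _ , refl))))) =
  wedge one j _ , odd (odd-2i+1 i) , SameEdge-refl
InEF⇒wedge _ (inj₂ (j , _ , inj₁ refl)) = wedge one j v3 , top , SameEdge-refl
InEF⇒wedge _ (inj₂ (j , _ , inj₂ refl)) = wedge two j v3 , top , SameEdge-refl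

distinct-wedges : ∀ {e f t u} → SameEdge e (edge t) → SameEdge f (edge u) → ¬ SameEdge e f → t ≢ u
distinct-wedges e≈t f≈u e≉f refl = e≉f (λ v → ⇔-sym (f≈u v) ⇔-∘ e≈t v)

lemma3p1 : (k : ℕ) → 1 ≤ k → (e f g : Edge) →
    InEF k e → InEF k f → InEF k g →
    ¬ SameEdge e f → ¬ SameEdge e g → ¬ SameEdge f g →
    ¬ Union4 e f g
lemma3p1 k 1≤k e f g e∈ f∈ g∈ e≉f e≉g f≉g (a , b , c , d , _ , _ , _ , _ , _ , _ , union)
  with InEF⇒wedge 1≤k e∈ | InEF⇒wedge 1≤k f∈ | InEF⇒wedge 1≤k g∈
... | t , vt , e≈t | u , vu , f≈u | w , vw , g≈w =
  1+n≰n (AtLeast⇒≤ five-vertices (listed ∘ Equivalence.to (union _)))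
  where
  P : Vtx → Set
  P v = v ∈ₑ e ⊎ v ∈ₑ f ⊎ v ∈ₑ g

  five-vertices : AtLeast 5 P
  five-vertices = three-wedges P t u w
    (vt , spanned P e≈t inj₁) (vu , spanned P f≈u (inj₂ ∘ inj₁)) (vw , spanned P g≈w (inj₂ ∘ inj₂))
    (distinct-wedges e≈t f≈u e≉f) (distinct-wedges e≈t g≈w e≉g) (distinct-wedges f≈u g≈w f≉g)

  listed : ∀ {v} → v ≡ a ⊎ v ≡ b ⊎ v ≡ c ⊎ v ≡ d → v ∈ a ∷ b ∷ c ∷ d ∷ []
  listed = [ here , [ there ∘ here , [ there ∘ there ∘ here , there ∘ there ∘ there ∘ here ] ] ]
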